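{- For every graph $G$, there exists a layering of $\mathcal{I}^1_{\mathrm{AR}}(G)$.
   Context: $\mathcal{I}^1_{\mathrm{AR}}(G)$ is the graph whose vertices are the non-empty independent sets of $G$, two being adjacent iff one is obtained from the other by adding or removing a single vertex. A layering of a graph $X$ is a partition of $V(X)$ into parts (layers) $V_1,\dots,V_p$ such that: (1) each layer is an independent set of $X$; (2) every neighbour of a vertex in $V_i$ lies in $V_{i-1}\cup V_{i+1}$; (3) for $2\leq i\leq p$, each vertex of $V_i$ has exactly $i$ neighbours in $V_{i-1}$; (4) for $1\leq i\leq p$, any two vertices of $V_i$ have at most one common neighbour in $V_{i-1}$ and at most one in $V_{i+1}$. -}

module Defs where

open import Data.Nat using (ℕ; suc; _≤_)
open import Data.Bool using (Bool; true; false; _∧_; not; T)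
open import Data.Fin using (Fin)
open import Data.Fin.Subset using (Subset; _∈_; _∉_; _∪_; ⁅_⁆)
open import Data.List using (List; allFin; length)
open import Data.Bool.ListAction using (all; any)
open import Data.List.Membership.Propositional using () renaming (_∈_ to _∈ₗ_)
open import Data.List.Relation.Unary.Unique.Propositional using (Unique)
open import Data.Vec using (lookup)
open import Data.Product using (Σ; ∃; ∃-syntax; _×_; proj₁)
open import Data.Sum using (_⊎_)
open import Function.Bundles using (_⇔_)
open import Relation.Binary.PropositionalEquality using (_≡_; _≢_)

record Graph : Set where
  field
    n     : ℕ
    adj   : Fin n → Fin n → Bool
    sym   : ∀ i j → adj i j ≡ adj j i
    irref : ∀ i → adj i i ≡ false
open Graph public

independentᵇ : (G : Graph) → Subset (n G) → Bool
independentᵇ G s =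
  all (λ i → all (λ j → not (lookup s i ∧ lookup s j ∧ adj G i j)) (allFin (n G)))
      (allFin (n G))

nonemptyᵇ : ∀ {m} → Subset m → Bool
nonemptyᵇ {m} s = any (λ i → lookup s i) (allFin m)

record GraphOn : Set₁ where
  field
    V : Set
    E : V → V → Set

AddOne : ∀ {m} → Subset m → Subset m → Set
AddOne s t = ∃[ v ] (v ∉ s × t ≡ s ∪ ⁅ v ⁆)

-- Vertices of I^1_AR(G): non-empty independent sets of G.
-- (The proof component lives in T _, which has a unique inhabitant.)
IARVertex : Graph → Set
IARVertex G = Σ (Subset (n G)) (λ s → T (nonemptyᵇ s ∧ independentᵇ G s))

IAR : Graph → GraphOn
IAR G = record
  { V = IARVertex G
  ; E = λ a b → AddOne (proj₁ a) (proj₁ b) ⊎ AddOne (proj₁ b) (proj₁ a)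
  }

HasSize : {A : Set} → (A → Set) → ℕ → Set
HasSize {A} P k =
  Σ (List A) (λ xs → Unique xs × length xs ≡ k × (∀ x → P x ⇔ (x ∈ₗ xs)))

AtMostOne : {A : Set} → (A → Set) → Set
AtMostOne P = ∀ x y → P x → P y → x ≡ y

-- A layering of X: a partition V_1,…,V_p of V(X); vertex v lies in layer
-- (layer v) ∈ {1,…,p}, and every index in {1,…,p} is used (parts non-empty).
record Layering (X : GraphOn) : Set where
  open GraphOn X
  field
    p        : ℕ
    layer    : V → ℕ
    inRange  : ∀ v → 1 ≤ layer v × layer v ≤ p
    onto     : ∀ i → 1 ≤ i → i ≤ p → ∃[ v ] layer v ≡ i
    indep    : ∀ u v → E u v → layer u ≢ layer v
    adjacentLayers : ∀ u v → E u v →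
                     layer v ≡ suc (layer u) ⊎ layer u ≡ suc (layer v)
    downDegree : ∀ v → 2 ≤ layer v →
                 HasSize (λ u → E v u × suc (layer u) ≡ layer v) (layer v)
    commonDown : ∀ u w → u ≢ w → layer u ≡ layer w →
                 AtMostOne (λ x → E u x × E w x × suc (layer x) ≡ layer u)
    commonUp   : ∀ u w → u ≢ w → layer u ≡ layer w →
                 AtMostOne (λ x → E u x × E w x × layer x ≡ suc (layer u))

{-# OPTIONS --safe #-}
-- Layer a non-empty independent set by its size. An edge adds or removes one
-- vertex, so it joins consecutive layers. The lower neighbours of s are the
-- sets s - x for x ∈ s: there are |s| of them, all non-empty and independent
-- once |s| ≥ 2. Two distinct sets of equal size have at most one common lower
-- neighbour (their intersection) and at most one common upper neighbour
-- (their union). The number of layers is the independence number; every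
-- smaller size occurs because subsets of independent sets are independent.
module Submission where

open import Defs hiding (sym)
open import Data.Bool using (Bool; true; false; _∧_; not; T)
open import Data.Bool.ListAction using (all)
open import Data.Bool.Properties using (T?; T-≡; T-∧; T-irrelevant; ∨-identityʳ)
open import Data.Empty using (⊥-elim)
open import Data.Fin using (Fin; zero; suc)
open import Data.Fin.Subset
  using (Subset; inside; outside; ⊥; _∪_; ⁅_⁆; _⊆_; Nonempty; ∣_∣)
  renaming (_∈_ to _∈ₛ_; _∉_ to _∉ₛ_)
open import Data.Fin.Subset.Properties
  using (∪-identityʳ; drop-there; ⊆-refl; ⊥⊆; out⊆; in⊆in; ∣⊥∣≡0)
open import Data.List using (List; []; _∷_; allFin; length; map; filter; _++_)
open import Data.List.Extrema.Nat using (argmax; argmax-all; f[xs]≤f[argmax])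
open import Data.List.Membership.Propositional using (_∈_; mapWith∈; lose)
open import Data.List.Membership.Propositional.Properties
  using (∈-map⁺; ∈-map⁻; ∈-++⁺ˡ; ∈-++⁺ʳ; ∈-filter⁺; ∈-allFin; map-mapWith∈; mapWith∈-id)
open import Data.List.Properties using (length-map)
open import Data.List.Relation.Unary.All as All using (All)
open import Data.List.Relation.Unary.All.Properties as Allₚ using (all⁺; all⁻; all-filter)
open import Data.List.Relation.Unary.Any using (here; there; satisfied)
open import Data.List.Relation.Unary.Any.Properties using (any⁺; any⁻)
open import Data.List.Relation.Unary.Unique.Propositional using (Unique; []; _∷_)
import Data.List.Relation.Unary.Unique.Propositional.Properties as Unique
open import Data.Nat using (ℕ; zero; suc; _≤_; _<_; z≤n; s≤s; s≤s⁻¹)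
open import Data.Nat.Properties using (≤-trans; 1+n≢n; m≢1+n+m)
open import Data.Product using (Σ; ∃-syntax; _×_; _,_; proj₁; proj₂)
import Data.Product as Product
open import Data.Sum using (_⊎_; inj₁; inj₂; swap)
import Data.Sum as Sum
open import Data.Vec using ([]; _∷_; lookup; here; there)
open import Data.Vec.Properties using (∷-injectiveʳ; []=⇒lookup; lookup⇒[]=)
open import Function using (_∘_)
open import Function.Bundles using (_⇔_; mk⇔; Equivalence)
open import Relation.Binary.PropositionalEquality
  using (_≡_; _≢_; refl; sym; trans; cong; cong₂; subst)
open import Relation.Nullary using (contradiction)
open import Relation.Unary using (Decidable)
open import Relation.Nullary.Irrelevant using (Irrelevant)

private
  variable
    m k : ℕ
    b : Bool
    s t u w x y : Subset m

module _ {A : Set} {Q : A → Set} (Q-irrelevant : ∀ {a} → Irrelevant (Q a)) where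

  Σ-≡-irrelevant : {u v : Σ A Q} → proj₁ u ≡ proj₁ v → u ≡ v
  Σ-≡-irrelevant {a , p} {.a , q} refl = cong (a ,_) (Q-irrelevant p q)

  HasSize-Σ : {P : Σ A Q → Set} {k : ℕ} (xs : List A) → Unique xs → length xs ≡ k →
              (∀ {a} → a ∈ xs → Q a) → (∀ v → P v ⇔ proj₁ v ∈ xs) → HasSize P k
  HasSize-Σ {P = P} {k} xs xs! |xs|≡k q P⇔∈ =
    ys , Unique.map⁻ (subst Unique (sym proj₁-ys) xs!) , |ys|≡k , λ v → mk⇔ (to v) (from v)
    where
    ys : List (Σ A Q)
    ys = mapWith∈ xs (λ a∈xs → _ , q a∈xs)

    proj₁-ys : map proj₁ ys ≡ xs
    proj₁-ys = trans (map-mapWith∈ xs _ proj₁) (mapWith∈-id xs)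

    |ys|≡k : length ys ≡ k
    |ys|≡k = trans (sym (length-map proj₁ ys)) (trans (cong length proj₁-ys) |xs|≡k)

    to : ∀ v → P v → v ∈ ys
    to v Pv with ∈-map⁻ proj₁ (subst (proj₁ v ∈_) (sym proj₁-ys) (Equivalence.to (P⇔∈ v) Pv))
    ... | w , w∈ys , v≡w = subst (_∈ ys) (sym (Σ-≡-irrelevant v≡w)) w∈ys

    from : ∀ v → v ∈ ys → P v
    from v v∈ys = Equivalence.from (P⇔∈ v) (subst (proj₁ v ∈_) proj₁-ys (∈-map⁺ proj₁ v∈ys))

-- t ⋖ s: s is t with one element added, the inductive form of AddOne t s.
infix 4 _⋖_

data _⋖_ : Subset m → Subset m → Set where
  here  : outside ∷ t ⋖ inside ∷ t
  there : t ⋖ s → b ∷ t ⋖ b ∷ s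

AddOne⇒⋖ : AddOne t s → t ⋖ s
AddOne⇒⋖ {t = t} (x , x∉t , refl) = ⋖-∪⁅⁆ t x x∉t
  where
  ⋖-∪⁅⁆ : ∀ {m} (t : Subset m) x → x ∉ₛ t → t ⋖ t ∪ ⁅ x ⁆
  ⋖-∪⁅⁆ (outside ∷ t) zero    _    rewrite ∪-identityʳ t = here
  ⋖-∪⁅⁆ (inside  ∷ t) zero    x∉t = contradiction here x∉t
  ⋖-∪⁅⁆ (b ∷ t)       (suc x) x∉t rewrite ∨-identityʳ b = there (⋖-∪⁅⁆ t x (x∉t ∘ there))

⋖⇒AddOne : t ⋖ s → AddOne t s
⋖⇒AddOne {t = outside ∷ t} here = zero , (λ ()) , cong (inside ∷_) (sym (∪-identityʳ t))
⋖⇒AddOne (there {b = b} t⋖s) with ⋖⇒AddOne t⋖s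
... | x , x∉t , s≡t∪x = suc x , x∉t ∘ drop-there , cong₂ _∷_ (sym (∨-identityʳ b)) s≡t∪x

t⋖s⇒∣s∣≡1+∣t∣ : t ⋖ s → ∣ s ∣ ≡ suc ∣ t ∣
t⋖s⇒∣s∣≡1+∣t∣ here                     = refl
t⋖s⇒∣s∣≡1+∣t∣ (there {b = inside}  t⋖s) = cong suc (t⋖s⇒∣s∣≡1+∣t∣ t⋖s)
t⋖s⇒∣s∣≡1+∣t∣ (there {b = outside} t⋖s) = t⋖s⇒∣s∣≡1+∣t∣ t⋖s

t⋖s⇒t⊆s : t ⋖ s → t ⊆ s
t⋖s⇒t⊆s here            (there x∈t) = there x∈t
t⋖s⇒t⊆s (there t⋖s) here        = here
t⋖s⇒t⊆s (there t⋖s) (there x∈t) = there (t⋖s⇒t⊆s t⋖s x∈t)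

common-lower-cover-unique : x ⋖ u → x ⋖ w → y ⋖ u → y ⋖ w → u ≢ w → x ≡ y
common-lower-cover-unique here        here        _           _           u≢w = contradiction refl u≢w
common-lower-cover-unique here        (there _)   here        _           _   = refl
common-lower-cover-unique (there _)   here        (there _)   here        _   = refl
common-lower-cover-unique (there _)   (there _)   here        here        u≢w = contradiction refl u≢w
common-lower-cover-unique (there x⋖u) (there x⋖w) (there y⋖u) (there y⋖w) u≢w =
  cong (_ ∷_) (common-lower-cover-unique x⋖u x⋖w y⋖u y⋖w (u≢w ∘ cong (_ ∷_)))

common-upper-cover-unique : u ⋖ x → w ⋖ x → u ⋖ y → w ⋖ y → u ≢ w → x ≡ y
common-upper-cover-unique here        here        _           _           u≢w = contradiction refl u≢w
common-upper-cover-unique here        (there _)   here        _           _   = refl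
common-upper-cover-unique (there _)   here        (there _)   here        _   = refl
common-upper-cover-unique (there _)   (there _)   here        here        u≢w = contradiction refl u≢w
common-upper-cover-unique (there u⋖x) (there w⋖x) (there u⋖y) (there w⋖y) u≢w =
  cong (_ ∷_) (common-upper-cover-unique u⋖x w⋖x u⋖y w⋖y (u≢w ∘ cong (_ ∷_)))

lowerCovers : Subset m → List (Subset m)
lowerCovers []            = []
lowerCovers (outside ∷ s) = map (outside ∷_) (lowerCovers s)
lowerCovers (inside  ∷ s) = (outside ∷ s) ∷ map (inside ∷_) (lowerCovers s)

length-lowerCovers : ∀ (s : Subset m) → length (lowerCovers s) ≡ ∣ s ∣
length-lowerCovers []            = refl
length-lowerCovers (outside ∷ s) = trans (length-map _ (lowerCovers s)) (length-lowerCovers s)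
length-lowerCovers (inside  ∷ s) =
  cong suc (trans (length-map _ (lowerCovers s)) (length-lowerCovers s))

lowerCovers-unique : ∀ (s : Subset m) → Unique (lowerCovers s)
lowerCovers-unique []            = []
lowerCovers-unique (outside ∷ s) = Unique.map⁺ ∷-injectiveʳ (lowerCovers-unique s)
lowerCovers-unique (inside  ∷ s) =
  Allₚ.map⁺ (All.universal (λ _ ()) (lowerCovers s))
  ∷ Unique.map⁺ ∷-injectiveʳ (lowerCovers-unique s)

∈-lowerCovers⁺ : t ⋖ s → t ∈ lowerCovers s
∈-lowerCovers⁺ here                      = here refl
∈-lowerCovers⁺ (there {b = outside} t⋖s) = ∈-map⁺ _ (∈-lowerCovers⁺ t⋖s)
∈-lowerCovers⁺ (there {b = inside}  t⋖s) = there (∈-map⁺ _ (∈-lowerCovers⁺ t⋖s))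

∈-lowerCovers⁻ : ∀ (s : Subset m) → t ∈ lowerCovers s → t ⋖ s
∈-lowerCovers⁻ (outside ∷ s) t∈ with ∈-map⁻ _ t∈
... | r , r∈ , refl = there (∈-lowerCovers⁻ s r∈)
∈-lowerCovers⁻ (inside ∷ s) (here refl) = here
∈-lowerCovers⁻ (inside ∷ s) (there t∈) with ∈-map⁻ _ t∈
... | r , r∈ , refl = there (∈-lowerCovers⁻ s r∈)

subset-of-size : ∀ (s : Subset m) {i} → i ≤ ∣ s ∣ → ∃[ t ] t ⊆ s × ∣ t ∣ ≡ i
subset-of-size     []            z≤n         = [] , ⊆-refl , refl
subset-of-size     (outside ∷ s) i≤∣s∣       =
  Product.map (outside ∷_) (Product.map₁ out⊆) (subset-of-size s i≤∣s∣)
subset-of-size {m} (inside ∷ s)  z≤n         = ⊥ , ⊥⊆ , ∣⊥∣≡0 m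
subset-of-size     (inside ∷ s)  (s≤s i≤∣s∣) =
  Product.map (inside ∷_) (Product.map in⊆in (cong suc)) (subset-of-size s i≤∣s∣)

subsets : ∀ m → List (Subset m)
subsets zero    = [] ∷ []
subsets (suc m) = map (inside ∷_) (subsets m) ++ map (outside ∷_) (subsets m)

∈-subsets : ∀ (s : Subset m) → s ∈ subsets m
∈-subsets []            = here refl
∈-subsets (inside  ∷ s) = ∈-++⁺ˡ (∈-map⁺ _ (∈-subsets s))
∈-subsets (outside ∷ s) = ∈-++⁺ʳ _ (∈-map⁺ _ (∈-subsets s))

Nonempty⇒0<∣∣ : Nonempty s → 0 < ∣ s ∣
Nonempty⇒0<∣∣ {s = inside  ∷ _} _                 = s≤s z≤n
Nonempty⇒0<∣∣ {s = outside ∷ _} (suc x , there x∈s) = Nonempty⇒0<∣∣ (x , x∈s)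

0<∣∣⇒Nonempty : ∀ (s : Subset m) → 0 < ∣ s ∣ → Nonempty s
0<∣∣⇒Nonempty (inside  ∷ s) _     = zero , here
0<∣∣⇒Nonempty (outside ∷ s) 0<∣s∣ = Product.map suc there (0<∣∣⇒Nonempty s 0<∣s∣)

∈⇔T-lookup : ∀ {x : Fin m} → x ∈ₛ s ⇔ T (lookup s x)
∈⇔T-lookup {s = s} {x} =
  mk⇔ (Equivalence.from T-≡ ∘ []=⇒lookup) (lookup⇒[]= x s ∘ Equivalence.to T-≡)

T-nonemptyᵇ : ∀ (s : Subset m) → T (nonemptyᵇ s) ⇔ Nonempty s
T-nonemptyᵇ {m} s = mk⇔
  (Product.map₂ (Equivalence.from ∈⇔T-lookup) ∘ satisfied ∘ any⁻ (lookup s) (allFin m))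
  (λ (x , x∈s) → any⁺ (lookup s) (lose (∈-allFin x) (Equivalence.to ∈⇔T-lookup x∈s)))

T-nonemptyᵇ⇔0<∣∣ : ∀ (s : Subset m) → T (nonemptyᵇ s) ⇔ 0 < ∣ s ∣
T-nonemptyᵇ⇔0<∣∣ s = mk⇔
  (Nonempty⇒0<∣∣ ∘ Equivalence.to (T-nonemptyᵇ s))
  (Equivalence.from (T-nonemptyᵇ s) ∘ 0<∣∣⇒Nonempty s)

not-∧-antitone : ∀ {a a′ b b′ c} → (T a′ → T a) → (T b′ → T b) →
                 T (not (a ∧ b ∧ c)) → T (not (a′ ∧ b′ ∧ c))
not-∧-antitone {a′ = false}                  _    _    _ = _
not-∧-antitone {a′ = true} {b′ = false}      _    _    _ = _
not-∧-antitone {false} {true}                a′⇒a _    _ = ⊥-elim (a′⇒a _)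
not-∧-antitone {true}  {true} {false} {true} _    b′⇒b _ = ⊥-elim (b′⇒b _)
not-∧-antitone {true}  {true} {true}  {true} _    _    h = h

all-mono : ∀ {A : Set} {f g : A → Bool} → (∀ a → T (f a) → T (g a)) →
           ∀ xs → T (all f xs) → T (all g xs)
all-mono {f = f} {g} f⇒g xs = all⁻ g ∘ All.map (f⇒g _) ∘ all⁺ f xs

independentᵇ-⊆ : ∀ G {s t : Subset (n G)} → t ⊆ s → T (independentᵇ G s) → T (independentᵇ G t)
independentᵇ-⊆ G {s} {t} t⊆s = all-mono (λ i → all-mono (λ j → not-∧-antitone {c = adj G i j}
  (T-lookup-⊆ i) (T-lookup-⊆ j)) (allFin (n G))) (allFin (n G))
  where
  T-lookup-⊆ : ∀ i → T (lookup t i) → T (lookup s i)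
  T-lookup-⊆ i = Equivalence.to ∈⇔T-lookup ∘ t⊆s ∘ Equivalence.from ∈⇔T-lookup

module _ (G : Graph) where

  open GraphOn (IAR G) using (E)

  IsIARVertex : Subset (n G) → Set
  IsIARVertex s = T (nonemptyᵇ s ∧ independentᵇ G s)

  IsIARVertex? : Decidable IsIARVertex
  IsIARVertex? s = T? (nonemptyᵇ s ∧ independentᵇ G s)

  IsIARVertex-⊆ : {s t : Subset (n G)} → t ⊆ s → 0 < ∣ t ∣ → IsIARVertex s → IsIARVertex t
  IsIARVertex-⊆ {s} {t} t⊆s 0<∣t∣ s-vertex = Equivalence.from T-∧
    ( Equivalence.from (T-nonemptyᵇ⇔0<∣∣ t) 0<∣t∣
    , independentᵇ-⊆ G t⊆s (proj₂ (Equivalence.to (T-∧ {nonemptyᵇ s}) s-vertex)) )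

  IsIARVertex⇒0<∣∣ : {s : Subset (n G)} → IsIARVertex s → 0 < ∣ s ∣
  IsIARVertex⇒0<∣∣ {s} =
    Equivalence.to (T-nonemptyᵇ⇔0<∣∣ s) ∘ proj₁ ∘ Equivalence.to (T-∧ {nonemptyᵇ s})

  vertex-≡ : {u v : IARVertex G} → proj₁ u ≡ proj₁ v → u ≡ v
  vertex-≡ = Σ-≡-irrelevant T-irrelevant

  size : IARVertex G → ℕ
  size = ∣_∣ ∘ proj₁

  edge⇒sizes-adjacent : ∀ u v → E u v → size v ≡ suc (size u) ⊎ size u ≡ suc (size v)
  edge⇒sizes-adjacent _ _ = Sum.map (t⋖s⇒∣s∣≡1+∣t∣ ∘ AddOne⇒⋖) (t⋖s⇒∣s∣≡1+∣t∣ ∘ AddOne⇒⋖)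

  edge⇒sizes-differ : ∀ u v → E u v → size u ≢ size v
  edge⇒sizes-differ u v e ∣u∣≡∣v∣ with edge⇒sizes-adjacent u v e
  ... | inj₁ ∣v∣≡1+∣u∣ = 1+n≢n (trans (sym ∣v∣≡1+∣u∣) (sym ∣u∣≡∣v∣))
  ... | inj₂ ∣u∣≡1+∣v∣ = 1+n≢n (trans (sym ∣u∣≡1+∣v∣) ∣u∣≡∣v∣)

  upward-edge⇒⋖ : ∀ u v → E u v → size v ≡ suc (size u) → proj₁ u ⋖ proj₁ v
  upward-edge⇒⋖ _ _ (inj₁ v≡u+x) _         = AddOne⇒⋖ v≡u+x
  upward-edge⇒⋖ _ _ (inj₂ u≡v+x) ∣v∣≡1+∣u∣ =
    contradiction (trans (t⋖s⇒∣s∣≡1+∣t∣ (AddOne⇒⋖ u≡v+x)) (cong suc ∣v∣≡1+∣u∣)) (m≢1+n+m _ {1})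

  -- ⊥ is only argmax's default: having size 0, it is returned only when G has no vertices.
  maximumIndependentSet : Subset (n G)
  maximumIndependentSet = argmax ∣_∣ ⊥ (filter IsIARVertex? (subsets (n G)))

  independenceNumber : ℕ
  independenceNumber = ∣ maximumIndependentSet ∣

  ∣∣≤independenceNumber : {s : Subset (n G)} → IsIARVertex s → ∣ s ∣ ≤ independenceNumber
  ∣∣≤independenceNumber {s} s-vertex =
    All.lookup (f[xs]≤f[argmax] ⊥ _) (∈-filter⁺ IsIARVertex? (∈-subsets s) s-vertex)

  maximumIndependentSet-isIARVertex : 0 < independenceNumber → IsIARVertex maximumIndependentSet
  maximumIndependentSet-isIARVertex = argmax-all ∣_∣ {P = λ s → 0 < ∣ s ∣ → IsIARVertex s}
    (λ 0<∣⊥∣ → contradiction (subst (0 <_) (∣⊥∣≡0 (n G)) 0<∣⊥∣) λ ())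
    (All.map (λ s-vertex _ → s-vertex) (all-filter IsIARVertex? (subsets (n G))))

  size-in-range : ∀ v → 0 < size v × size v ≤ independenceNumber
  size-in-range (s , s-vertex) =
    IsIARVertex⇒0<∣∣ {s} s-vertex , ∣∣≤independenceNumber {s} s-vertex

  every-size-occurs : ∀ i → 0 < i → i ≤ independenceNumber → ∃[ v ] size v ≡ i
  every-size-occurs i 0<i i≤α with subset-of-size maximumIndependentSet i≤α
  ... | t , t⊆max , ∣t∣≡i =
    (t , IsIARVertex-⊆ t⊆max (subst (0 <_) (sym ∣t∣≡i) 0<i)
           (maximumIndependentSet-isIARVertex (≤-trans 0<i i≤α)))
    , ∣t∣≡i

  lower-neighbours-HasSize : ∀ v → 2 ≤ size v →
                             HasSize (λ u → E v u × suc (size u) ≡ size v) (size v)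
  lower-neighbours-HasSize (s , s-vertex) 2≤∣s∣ =
    HasSize-Σ T-irrelevant (lowerCovers s) (lowerCovers-unique s) (length-lowerCovers s)
      lower-cover-vertex
      λ u → mk⇔
        (λ (e , 1+∣u∣≡∣s∣) → ∈-lowerCovers⁺ (upward-edge⇒⋖ u (s , s-vertex) (swap e) (sym 1+∣u∣≡∣s∣)))
        (λ u∈ → let u⋖s = ∈-lowerCovers⁻ s u∈ in inj₂ (⋖⇒AddOne u⋖s) , sym (t⋖s⇒∣s∣≡1+∣t∣ u⋖s))
    where
    lower-cover-vertex : {t : Subset (n G)} → t ∈ lowerCovers s → IsIARVertex t
    lower-cover-vertex t∈ = let t⋖s = ∈-lowerCovers⁻ s t∈ in
      IsIARVertex-⊆ (t⋖s⇒t⊆s t⋖s) (s≤s⁻¹ (subst (2 ≤_) (t⋖s⇒∣s∣≡1+∣t∣ t⋖s) 2≤∣s∣)) s-vertex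

  common-lower-neighbour-unique : ∀ u w → u ≢ w → size u ≡ size w →
                                  AtMostOne (λ x → E u x × E w x × suc (size x) ≡ size u)
  common-lower-neighbour-unique u w u≢w ∣u∣≡∣w∣ x y (ux , wx , 1+∣x∣≡∣u∣) (uy , wy , 1+∣y∣≡∣u∣) =
    vertex-≡ (common-lower-cover-unique
      (upward-edge⇒⋖ x u (swap ux) (sym 1+∣x∣≡∣u∣))
      (upward-edge⇒⋖ x w (swap wx) (sym (trans 1+∣x∣≡∣u∣ ∣u∣≡∣w∣)))
      (upward-edge⇒⋖ y u (swap uy) (sym 1+∣y∣≡∣u∣))
      (upward-edge⇒⋖ y w (swap wy) (sym (trans 1+∣y∣≡∣u∣ ∣u∣≡∣w∣)))
      (u≢w ∘ vertex-≡))

  common-upper-neighbour-unique : ∀ u w → u ≢ w → size u ≡ size w →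
                                  AtMostOne (λ x → E u x × E w x × size x ≡ suc (size u))
  common-upper-neighbour-unique u w u≢w ∣u∣≡∣w∣ x y (ux , wx , ∣x∣≡1+∣u∣) (uy , wy , ∣y∣≡1+∣u∣) =
    vertex-≡ (common-upper-cover-unique
      (upward-edge⇒⋖ u x ux ∣x∣≡1+∣u∣)
      (upward-edge⇒⋖ w x wx (trans ∣x∣≡1+∣u∣ (cong suc ∣u∣≡∣w∣)))
      (upward-edge⇒⋖ u y uy ∣y∣≡1+∣u∣)
      (upward-edge⇒⋖ w y wy (trans ∣y∣≡1+∣u∣ (cong suc ∣u∣≡∣w∣)))
      (u≢w ∘ vertex-≡))

lemma4p3 : (G : Graph) → Layering (IAR G)
lemma4p3 G = record
  { p              = independenceNumber G
  ; layer          = size G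
  ; inRange        = size-in-range G
  ; onto           = every-size-occurs G
  ; indep          = edge⇒sizes-differ G
  ; adjacentLayers = edge⇒sizes-adjacent G
  ; downDegree     = lower-neighbours-HasSize G
  ; commonDown     = common-lower-neighbour-unique G
  ; commonUp       = common-upper-neighbour-unique G
  }
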